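{- If $m,d$ are positive integers, then $\binom{m}{0}_{\!d} + \binom{m}{1}_{\!d} + \dots + \binom{m}{d}_{\!d} = \binom{m+d}{d}_{\!d}$.
   Context: The Turán graph $T_d(n)$ is the complete $d$-partite graph on $n$ vertices with parts of sizes $\lfloor n/d\rfloor$ or $\lceil n/d\rceil$ (for $n\le d$ it is $K_n$). For integers $n,k$, $\binom{n}{k}_{\!d}$ is the number of $k$-cliques of $T_d(n)$ when $0\le k\le n$ (so $\binom{n}{0}_{\!d}=1$ for $n\ge0$), and $\binom{n}{k}_{\!d}=0$ if $k>n$, $k<0$ or $n<0$. -}

module Defs where

open import Data.Bool using (Bool; true; false; _∧_; _∨_; not)
open import Data.Nat using (ℕ; zero; suc; _+_; _%_; _≡ᵇ_; NonZero)
open import Data.Fin using (Fin; toℕ)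
open import Data.Fin.Subset using (Subset; inside; outside; ∣_∣)
open import Data.Vec using (Vec; []; _∷_; lookup)
open import Data.List using (List; []; _∷_; map; _++_; filterᵇ; length; allFin; upTo)
open import Data.Bool.ListAction using (and)
open import Data.Nat.ListAction using (sum)

-- The Turán graph T_d(n) on vertex set Fin n: vertex i lies in part (i mod d).
-- Part sizes are then ⌊n/d⌋ or ⌈n/d⌉, and for n ≤ d all parts are singletons
-- (so T_d(n) = K_n).
part : (d : ℕ) .{{_ : NonZero d}} → {n : ℕ} → Fin n → ℕ
part d i = toℕ i % d

turanAdj : (d : ℕ) .{{_ : NonZero d}} → {n : ℕ} → Fin n → Fin n → Bool
turanAdj d i j = not (part d i ≡ᵇ part d j)

allSubsets : (n : ℕ) → List (Subset n)
allSubsets zero = [] ∷ []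
allSubsets (suc n) = map (inside ∷_) (allSubsets n) ++ map (outside ∷_) (allSubsets n)

isTuranClique : (d : ℕ) .{{_ : NonZero d}} → {n : ℕ} → Subset n → Bool
isTuranClique d {n} s =
  and (map (λ i → and (map (λ j →
         not (lookup s i ∧ lookup s j) ∨ (toℕ i ≡ᵇ toℕ j) ∨ turanAdj d i j)
       (allFin n))) (allFin n))

-- binomT n k d = number of k-cliques of T_d(n)  (written (n choose k)_d in the paper).
-- For k > n there are no k-element subsets, so this is 0, matching the convention.
binomT : (n k d : ℕ) .{{_ : NonZero d}} → ℕ
binomT n k d = length (filterᵇ (λ s → isTuranClique d s ∧ (∣ s ∣ ≡ᵇ k)) (allSubsets n))

sumBinomT : (m d : ℕ) .{{_ : NonZero d}} → ℕ
sumBinomT m d = sum (map (λ k → binomT m k d) (upTo (suc d)))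

module Submission where

-- Colour vertex i of T_d(n) by i % d. A set of vertices is a clique iff its colours are pairwise
-- distinct (it is "rainbow"), i.e. it takes at most one vertex from each part. Hence T_d(m) has
-- ∏_{r<d} (1 + a_r) cliques in all, where a_r is the size of part r, and all of them have at most
-- d vertices; while the d-cliques of T_d(m + d) number ∏_{r<d} a′_r, where a′_r = 1 + a_r because
-- the d extra vertices add one vertex to every part. Both product formulas are proved by induction
-- on the number of vertices, deleting vertex 0; taking it into a rainbow set forbids its colour
-- for the remaining vertices, so the formulas are stated for rainbow sets avoiding a set F of
-- forbidden colours, and then only the allowed colours contribute factors.

open import Algebra.Bundles using (CommutativeMonoid)
open import Data.Bool using (Bool; true; false; _∧_; _∨_; not; if_then_else_; T; T?)
open import Data.Bool.Properties
  using (∧-comm; ∧-idem; ∧-zeroʳ; ∧-identityʳ; ∨-zeroʳ; ∨-distribˡ-∧; ∧-commutativeMonoid;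
         ∨-∧-booleanAlgebra; if-eta; if-cong; if-cong-else)
open import Data.Bool.ListAction using (and)
open import Data.Fin as Fin using (Fin; toℕ; fromℕ<; punchIn)
open import Data.Fin.Patterns using (0F)
open import Data.Fin.Properties using (toℕ-fromℕ<; toℕ-injective; toℕ<n; punchInᵢ≢i)
open import Data.Fin.Subset using (Subset; inside; outside; ∣_∣)
open import Data.List using (List; []; _∷_; _++_; map; filterᵇ; length; allFin; applyUpTo)
open import Data.List.Properties using (length-++; filter-++; filter-≐; map-cong; map-tabulate; map-upTo)
open import Data.Nat using (ℕ; zero; suc; _+_; _*_; _%_; _≡ᵇ_; _<_; _≤_; NonZero; s≤s; s<s⁻¹)
open import Data.Nat.DivMod using (m%n<n; m<n⇒m%n≡m; [m+n]%n≡m%n)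
import Data.Nat.ListAction as List
open import Data.Nat.Properties
  using (_≟_; +-identityʳ; +-assoc; +-comm; *-identityʳ; *-suc; <⇒≤; <⇒≢; ≤-refl; ≤-reflexive;
         m<1+n⇒m<n∨m≡n; +-0-commutativeMonoid; *-1-commutativeMonoid; +-commutativeSemigroup)
open import Data.Product using (_,_)
open import Data.Sum using (inj₁; inj₂)
open import Data.Vec using ([]; _∷_; lookup)
open import Function using (_∘_; id)
open import Relation.Binary.PropositionalEquality
  using (_≡_; _≢_; ≢-sym; refl; sym; trans; cong; cong₂; subst; module ≡-Reasoning)
open import Relation.Nullary.Decidable using (dec-true; dec-false)

open import Algebra.Lattice.Properties.BooleanAlgebra ∨-∧-booleanAlgebra using (deMorgan₂)
open import Algebra.Properties.CommutativeSemigroup +-commutativeSemigroup using (x∙yz≈y∙xz)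
open import Algebra.Properties.CommutativeMonoid.Sum +-0-commutativeMonoid
  using (sum-syntax; sum-cong-≗; ∑-distrib-+; sum-replicate-zero)
open import Algebra.Properties.CommutativeMonoid.Sum *-1-commutativeMonoid
  using ()
  renaming (sum to product; sum-cong-≗ to product-cong-≗; sum-replicate-zero to product-replicate-one)
open import Algebra.Solver.CommutativeMonoid ∧-commutativeMonoid using (solve; _⊕_; _⊜_)

open import Defs

≡ᵇ-sym : ∀ m n → (m ≡ᵇ n) ≡ (n ≡ᵇ m)
≡ᵇ-sym zero    zero    = refl
≡ᵇ-sym zero    (suc n) = refl
≡ᵇ-sym (suc m) zero    = refl
≡ᵇ-sym (suc m) (suc n) = ≡ᵇ-sym m n

true-false⇒≢ : ∀ {A : Set} (F : A → Bool) {x y} → F x ≡ true → F y ≡ false → x ≢ y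
true-false⇒≢ F F-x F-y refl with trans (sym F-x) F-y
... | ()

and-map-∧ : ∀ {A : Set} (f g : A → Bool) xs →
            and (map (λ x → f x ∧ g x) xs) ≡ and (map f xs) ∧ and (map g xs)
and-map-∧ f g []       = refl
and-map-∧ f g (x ∷ xs) =
  trans (cong ((f x ∧ g x) ∧_) (and-map-∧ f g xs))
        (solve 4 (λ a b c d → (a ⊕ b) ⊕ (c ⊕ d) ⊜ (a ⊕ c) ⊕ (b ⊕ d)) refl (f x) (g x) _ _)

allᵇ : ∀ {n} → (Fin n → Bool) → Bool
allᵇ {n} f = and (map f (allFin n))

allᵇ-suc : ∀ {n} (f : Fin (suc n) → Bool) → allᵇ f ≡ f 0F ∧ allᵇ (f ∘ Fin.suc)
allᵇ-suc f =
  cong (λ bs → f 0F ∧ and bs) (trans (map-tabulate Fin.suc f) (sym (map-tabulate id (f ∘ Fin.suc))))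

allᵇ-cong : ∀ {n} {f g : Fin n → Bool} → (∀ i → f i ≡ g i) → allᵇ f ≡ allᵇ g
allᵇ-cong {n} f≗g = cong and (map-cong f≗g (allFin n))

allᵇ-true : ∀ {n} → allᵇ {n} (λ _ → true) ≡ true
allᵇ-true {zero}  = refl
allᵇ-true {suc n} = trans (allᵇ-suc {n} (λ _ → true)) (allᵇ-true {n})

allPairs : ∀ {n} → (Fin n → Fin n → Bool) → Bool
allPairs P = allᵇ (λ i → allᵇ (P i))

allPairs-suc : ∀ {n} (P : Fin (suc n) → Fin (suc n) → Bool) → (∀ i j → P i j ≡ P j i) →
               allPairs P ≡
               P 0F 0F ∧ (allᵇ (P 0F ∘ Fin.suc) ∧ allPairs (λ i j → P (Fin.suc i) (Fin.suc j)))
allPairs-suc {n} P P-sym = begin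
  allPairs P
    ≡⟨ allᵇ-suc (λ i → allᵇ (P i)) ⟩
  allᵇ (P 0F) ∧ allᵇ (λ i → allᵇ (P (Fin.suc i)))
    ≡⟨ cong₂ _∧_ (allᵇ-suc (P 0F)) (allᵇ-cong (λ i → allᵇ-suc (P (Fin.suc i)))) ⟩
  (P 0F 0F ∧ row) ∧ allᵇ (λ i → column i ∧ allᵇ (P (Fin.suc i) ∘ Fin.suc))
    ≡⟨ cong ((P 0F 0F ∧ row) ∧_)
            (and-map-∧ column (λ i → allᵇ (P (Fin.suc i) ∘ Fin.suc)) (allFin n)) ⟩
  (P 0F 0F ∧ row) ∧ (allᵇ column ∧ rest)
    ≡⟨ cong (λ b → (P 0F 0F ∧ row) ∧ (b ∧ rest)) (allᵇ-cong (λ i → P-sym (Fin.suc i) 0F)) ⟩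
  (P 0F 0F ∧ row) ∧ (row ∧ rest)
    ≡⟨ solve 3 (λ p r s → (p ⊕ r) ⊕ (r ⊕ s) ⊜ p ⊕ ((r ⊕ r) ⊕ s)) refl (P 0F 0F) row rest ⟩
  P 0F 0F ∧ ((row ∧ row) ∧ rest)
    ≡⟨ cong (λ b → P 0F 0F ∧ (b ∧ rest)) (∧-idem row) ⟩
  P 0F 0F ∧ (row ∧ rest) ∎
  where
  open ≡-Reasoning
  row = allᵇ (P 0F ∘ Fin.suc)
  column = λ i → P (Fin.suc i) 0F
  rest = allPairs (λ i j → P (Fin.suc i) (Fin.suc j))

none : ℕ → Bool
none _ = false

forbid : ℕ → (ℕ → Bool) → ℕ → Bool
forbid r F x = (r ≡ᵇ x) ∨ F x

forbid-self : ∀ r F → forbid r F r ≡ true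
forbid-self r F = cong (_∨ F r) (dec-true (r ≟ r) refl)

forbid-≢ : ∀ {r x} F → r ≢ x → forbid r F x ≡ F x
forbid-≢ {r} {x} F r≢x = cong (_∨ F x) (dec-false (r ≟ x) r≢x)

compatible : (ℕ → ℕ) → ∀ {n} → Subset n → Fin n → Fin n → Bool
compatible c s i j =
  not (lookup s i ∧ lookup s j) ∨ (toℕ i ≡ᵇ toℕ j) ∨ not (c (toℕ i) ≡ᵇ c (toℕ j))

compatible-sym : ∀ c {n} (s : Subset n) i j → compatible c s i j ≡ compatible c s j i
compatible-sym c s i j =
  cong₂ (λ both x → not both ∨ x) (∧-comm (lookup s i) (lookup s j))
        (cong₂ (λ same x → same ∨ not x)
               (≡ᵇ-sym (toℕ i) (toℕ j)) (≡ᵇ-sym (c (toℕ i)) (c (toℕ j))))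

isClique : (ℕ → ℕ) → ∀ {n} → Subset n → Bool
isClique c s = allPairs (compatible c s)

avoids : (ℕ → ℕ) → (ℕ → Bool) → ∀ {n} → Subset n → Bool
avoids c F s = allᵇ (λ i → not (lookup s i) ∨ not (F (c (toℕ i))))

isRainbow : (ℕ → ℕ) → (ℕ → Bool) → ∀ {n} → Subset n → Bool
isRainbow c F []            = true
isRainbow c F (outside ∷ s) = isRainbow (c ∘ suc) F s
isRainbow c F (inside  ∷ s) = not (F (c 0)) ∧ isRainbow (c ∘ suc) (forbid (c 0) F) s

isClique-outside : ∀ c {n} (s : Subset n) → isClique c (outside ∷ s) ≡ isClique (c ∘ suc) s
isClique-outside c {n} s =
  trans (allPairs-suc _ (compatible-sym c (outside ∷ s)))
        (cong (_∧ isClique (c ∘ suc) s) (allᵇ-true {n}))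

isClique-inside : ∀ c {n} (s : Subset n) →
                  isClique c (inside ∷ s) ≡ avoids (c ∘ suc) (c 0 ≡ᵇ_) s ∧ isClique (c ∘ suc) s
isClique-inside c s = allPairs-suc _ (compatible-sym c (inside ∷ s))

avoids-∨ : ∀ c G F {n} (s : Subset n) →
           avoids c (λ x → G x ∨ F x) s ≡ avoids c G s ∧ avoids c F s
avoids-∨ c G F {n} s = trans (allᵇ-cong distrib) (and-map-∧ _ _ (allFin n))
  where
  distrib : ∀ i → not (lookup s i) ∨ not (G (c (toℕ i)) ∨ F (c (toℕ i)))
                 ≡ (not (lookup s i) ∨ not (G (c (toℕ i))))
                   ∧ (not (lookup s i) ∨ not (F (c (toℕ i))))
  distrib i = trans (cong (not (lookup s i) ∨_) (deMorgan₂ (G (c (toℕ i))) (F (c (toℕ i)))))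
                    (∨-distribˡ-∧ (not (lookup s i)) _ _)

avoids-∷ : ∀ c F {n} b (s : Subset n) →
           avoids c F (b ∷ s) ≡ (not b ∨ not (F (c 0))) ∧ avoids (c ∘ suc) F s
avoids-∷ c F b s = allᵇ-suc (λ i → not (lookup (b ∷ s) i) ∨ not (F (c (toℕ i))))

isClique∧avoids≡isRainbow : ∀ c F {n} (s : Subset n) →
                            isClique c s ∧ avoids c F s ≡ isRainbow c F s
isClique∧avoids≡isRainbow c F []            = refl
isClique∧avoids≡isRainbow c F (outside ∷ s) =
  trans (cong₂ _∧_ (isClique-outside c s) (avoids-∷ c F outside s))
        (isClique∧avoids≡isRainbow (c ∘ suc) F s)
isClique∧avoids≡isRainbow c F (inside ∷ s) = begin
  isClique c (inside ∷ s) ∧ avoids c F (inside ∷ s)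
    ≡⟨ cong₂ _∧_ (isClique-inside c s) (avoids-∷ c F inside s) ⟩
  (avoidsC₀ ∧ isClique c′ s) ∧ (allowed₀ ∧ avoids c′ F s)
    ≡⟨ solve 4 (λ x q f v → (x ⊕ q) ⊕ (f ⊕ v) ⊜ f ⊕ (q ⊕ (x ⊕ v))) refl
               avoidsC₀ (isClique c′ s) allowed₀ (avoids c′ F s) ⟩
  allowed₀ ∧ (isClique c′ s ∧ (avoidsC₀ ∧ avoids c′ F s))
    ≡⟨ cong (λ b → allowed₀ ∧ (isClique c′ s ∧ b)) (avoids-∨ c′ (c 0 ≡ᵇ_) F s) ⟨
  allowed₀ ∧ (isClique c′ s ∧ avoids c′ (forbid (c 0) F) s)
    ≡⟨ cong (allowed₀ ∧_) (isClique∧avoids≡isRainbow c′ (forbid (c 0) F) s) ⟩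
  isRainbow c F (inside ∷ s) ∎
  where
  open ≡-Reasoning
  c′ = c ∘ suc
  allowed₀ = not (F (c 0))
  avoidsC₀ = avoids c′ (c 0 ≡ᵇ_) s

isTuranClique≡isRainbow : ∀ d .{{_ : NonZero d}} {n} (s : Subset n) →
                          isTuranClique d s ≡ isRainbow (λ i → i % d) none s
isTuranClique≡isRainbow d {n} s = begin
  -- isTuranClique d s unfolds to isClique (_% d) s.
  isTuranClique d s                                    ≡⟨ sym (∧-identityʳ _) ⟩
  isClique c s ∧ true                                  ≡⟨ cong (isClique c s ∧_) (sym avoids-none) ⟩
  isClique c s ∧ avoids c none s                       ≡⟨ isClique∧avoids≡isRainbow c none s ⟩
  isRainbow c none s                                   ∎
  where
  open ≡-Reasoning
  c = λ i → i % d
  avoids-none : avoids c none s ≡ true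
  avoids-none = trans (allᵇ-cong (λ i → ∨-zeroʳ (not (lookup s i)))) (allᵇ-true {n})

count : ∀ {A : Set} → (A → Bool) → List A → ℕ
count p xs = length (filterᵇ p xs)

count-++ : ∀ {A : Set} (p : A → Bool) xs ys → count p (xs ++ ys) ≡ count p xs + count p ys
count-++ p xs ys = trans (cong length (filter-++ (T? ∘ p) xs ys)) (length-++ (filterᵇ p xs))

count-map : ∀ {A B : Set} (p : B → Bool) (f : A → B) xs → count p (map f xs) ≡ count (p ∘ f) xs
count-map p f []       = refl
count-map p f (x ∷ xs) with p (f x)
... | true  = cong suc (count-map p f xs)
... | false = count-map p f xs

count-cong : ∀ {A : Set} {p q : A → Bool} → (∀ x → p x ≡ q x) → ∀ xs → count p xs ≡ count q xs
count-cong {p = p} {q} p≗q xs =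
  cong length (filter-≐ (T? ∘ p) (T? ∘ q) ((λ {x} → subst T (p≗q x)) , (λ {x} → subst T (sym (p≗q x)))) xs)

count-false : ∀ {A : Set} {p : A → Bool} → (∀ x → p x ≡ false) → ∀ xs → count p xs ≡ 0
count-false p≡false []       = refl
count-false p≡false (x ∷ xs) rewrite p≡false x = count-false p≡false xs

count-allSubsets-suc : ∀ {n} (p : Subset (suc n) → Bool) →
                       count p (allSubsets (suc n))
                       ≡ count (p ∘ (inside ∷_)) (allSubsets n)
                         + count (p ∘ (outside ∷_)) (allSubsets n)
count-allSubsets-suc {n} p =
  trans (count-++ p (map (inside ∷_) (allSubsets n)) _)
        (cong₂ _+_ (count-map p _ (allSubsets n)) (count-map p _ (allSubsets n)))

rainbowCount : (ℕ → ℕ) → (ℕ → Bool) → ℕ → ℕ → ℕ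
rainbowCount c F n k = count (λ s → isRainbow c F s ∧ (∣ s ∣ ≡ᵇ k)) (allSubsets n)

binomT≡rainbowCount : ∀ n k d .{{_ : NonZero d}} → binomT n k d ≡ rainbowCount (λ i → i % d) none n k
binomT≡rainbowCount n k d =
  count-cong (λ s → cong (_∧ (∣ s ∣ ≡ᵇ k)) (isTuranClique≡isRainbow d s)) (allSubsets n)

rainbowCount-suc : ∀ c F n k →
                   rainbowCount c F (suc n) k
                   ≡ count (λ s → isRainbow c F (inside ∷ s) ∧ (suc ∣ s ∣ ≡ᵇ k)) (allSubsets n)
                     + rainbowCount (c ∘ suc) F n k
rainbowCount-suc c F n k = count-allSubsets-suc {n} (λ s → isRainbow c F s ∧ (∣ s ∣ ≡ᵇ k))

rainbowCount-zero : ∀ c F n → rainbowCount c F (suc n) 0 ≡ rainbowCount (c ∘ suc) F n 0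
rainbowCount-zero c F n =
  trans (rainbowCount-suc c F n 0)
        (cong (_+ rainbowCount (c ∘ suc) F n 0) (count-false (λ _ → ∧-zeroʳ _) (allSubsets n)))

rainbowCount-forbidden : ∀ c F n k → F (c 0) ≡ true →
                         rainbowCount c F (suc n) k ≡ rainbowCount (c ∘ suc) F n k
rainbowCount-forbidden c F n k F-c₀ =
  trans (rainbowCount-suc c F n k)
        (cong (_+ rainbowCount (c ∘ suc) F n k) (count-false with-vertex₀ (allSubsets n)))
  where
  with-vertex₀ : ∀ s → isRainbow c F (inside ∷ s) ∧ (suc ∣ s ∣ ≡ᵇ k) ≡ false
  with-vertex₀ s = cong (λ b → (not b ∧ isRainbow (c ∘ suc) (forbid (c 0) F) s) ∧ _) F-c₀

rainbowCount-allowed : ∀ c F n k → F (c 0) ≡ false →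
                       rainbowCount c F (suc n) (suc k)
                       ≡ rainbowCount (c ∘ suc) (forbid (c 0) F) n k + rainbowCount (c ∘ suc) F n (suc k)
rainbowCount-allowed c F n k F-c₀ =
  trans (rainbowCount-suc c F n (suc k))
        (cong (_+ rainbowCount (c ∘ suc) F n (suc k)) (count-cong with-vertex₀ (allSubsets n)))
  where
  with-vertex₀ : ∀ s → isRainbow c F (inside ∷ s) ∧ (suc ∣ s ∣ ≡ᵇ suc k)
                     ≡ isRainbow (c ∘ suc) (forbid (c 0) F) s ∧ (∣ s ∣ ≡ᵇ k)
  with-vertex₀ s = cong (λ b → (not b ∧ isRainbow (c ∘ suc) (forbid (c 0) F) s) ∧ _) F-c₀

partSize : (ℕ → ℕ) → ℕ → ℕ → ℕ
partSize c zero    r = 0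
partSize c (suc n) r = partSize c n r + (if c n ≡ᵇ r then 1 else 0)

partSize-suc : ∀ c n r → partSize c (suc n) r ≡ (if c 0 ≡ᵇ r then 1 else 0) + partSize (c ∘ suc) n r
partSize-suc c zero    r = +-comm 0 _
partSize-suc c (suc n) r =
  trans (cong (_+ (if c (suc n) ≡ᵇ r then 1 else 0)) (partSize-suc c n r))
        (+-assoc (if c 0 ≡ᵇ r then 1 else 0) (partSize (c ∘ suc) n r) _)

partSize-suc-≡ : ∀ c n → partSize c (suc n) (c 0) ≡ suc (partSize (c ∘ suc) n (c 0))
partSize-suc-≡ c n =
  trans (partSize-suc c n (c 0))
        (cong (_+ partSize (c ∘ suc) n (c 0)) (if-cong (dec-true (c 0 ≟ c 0) refl)))

partSize-suc-≢ : ∀ c n {r} → c 0 ≢ r → partSize c (suc n) r ≡ partSize (c ∘ suc) n r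
partSize-suc-≢ c n {r} c₀≢r =
  trans (partSize-suc c n r) (cong (_+ partSize (c ∘ suc) n r) (if-cong (dec-false (c 0 ≟ r) c₀≢r)))

module _ {d : ℕ} .{{_ : NonZero d}} where

  partSize-%-≡0 : ∀ {n r} → n ≤ d → n ≤ r → partSize (_% d) n r ≡ 0
  partSize-%-≡0 {zero}  _   _   = refl
  partSize-%-≡0 {suc n} {r} n<d n<r =
    cong₂ _+_ (partSize-%-≡0 (<⇒≤ n<d) (<⇒≤ n<r))
              (if-cong (dec-false (n % d ≟ r) (λ eq → <⇒≢ n<r (trans (sym (m<n⇒m%n≡m n<d)) eq))))

  partSize-%-≡1 : ∀ {n r} → n ≤ d → r < n → partSize (_% d) n r ≡ 1
  partSize-%-≡1 {suc n} {r} n<d r<1+n with m<1+n⇒m<n∨m≡n r<1+n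
  ... | inj₁ r<n  =
    cong₂ _+_ (partSize-%-≡1 (<⇒≤ n<d) r<n)
              (if-cong (dec-false (n % d ≟ r) (λ eq → <⇒≢ r<n (trans (sym eq) (m<n⇒m%n≡m n<d)))))
  ... | inj₂ refl =
    cong₂ _+_ (partSize-%-≡0 (<⇒≤ n<d) ≤-refl) (if-cong (dec-true (n % d ≟ n) (m<n⇒m%n≡m n<d)))

  partSize-%-+ : ∀ m {r} → r < d → partSize (_% d) (m + d) r ≡ suc (partSize (_% d) m r)
  partSize-%-+ zero    r<d = partSize-%-≡1 ≤-refl r<d
  partSize-%-+ (suc m) {r} r<d =
    cong₂ _+_ (partSize-%-+ m r<d) (cong (λ x → if x ≡ᵇ r then 1 else 0) ([m+n]%n≡m%n m d))

module _ {a ℓ} (M : CommutativeMonoid a ℓ) where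
  open CommutativeMonoid M using (Carrier; _≈_; _∙_; ∙-congʳ; ∙-congˡ; setoid; commutativeSemigroup)
  open import Algebra.Properties.CommutativeSemigroup commutativeSemigroup using (xy∙z≈zy∙x)
  open import Algebra.Properties.CommutativeMonoid.Sum M
    using () renaming (sum to ∑; sum-remove to ∑-remove; sum-cong-≋ to ∑-cong-≋)
  open import Relation.Binary.Reasoning.Setoid setoid

  ∑-exchange : ∀ {d} (f g : ℕ → Carrier) {r₀} → r₀ < d → (∀ r → r ≢ r₀ → f r ≈ g r) →
               ∑ {d} (f ∘ toℕ) ∙ g r₀ ≈ ∑ {d} (g ∘ toℕ) ∙ f r₀
  ∑-exchange {suc d} f g {r₀} r₀<d f≈g = begin
    ∑ {suc d} (f ∘ toℕ) ∙ g r₀                   ≈⟨ ∙-congʳ (∑-remove {i = i} (f ∘ toℕ)) ⟩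
    (f (toℕ i) ∙ ∑ (f ∘ toℕ ∘ punchIn i)) ∙ g r₀  ≈⟨ ∙-congʳ (∙-congˡ (∑-cong-≋ f≈g-off-i)) ⟩
    (f (toℕ i) ∙ R) ∙ g r₀                        ≡⟨ cong (λ r → (f r ∙ R) ∙ g r₀) i≡r₀ ⟩
    (f r₀ ∙ R) ∙ g r₀                             ≈⟨ xy∙z≈zy∙x (f r₀) R (g r₀) ⟩
    (g r₀ ∙ R) ∙ f r₀                             ≡⟨ cong (λ r → (g r ∙ R) ∙ f r₀) i≡r₀ ⟨
    (g (toℕ i) ∙ R) ∙ f r₀                        ≈⟨ ∙-congʳ (∑-remove {i = i} (g ∘ toℕ)) ⟨
    ∑ {suc d} (g ∘ toℕ) ∙ f r₀                   ∎
    where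
    i = fromℕ< r₀<d
    i≡r₀ = toℕ-fromℕ< r₀<d
    R = ∑ (g ∘ toℕ ∘ punchIn i)
    f≈g-off-i : ∀ j → f (toℕ (punchIn i j)) ≈ g (toℕ (punchIn i j))
    f≈g-off-i j = f≈g _ (λ eq → punchInᵢ≢i i j (toℕ-injective (trans eq (sym i≡r₀))))

allowedParts : ℕ → (ℕ → Bool) → ℕ
allowedParts d F = ∑[ r < d ] (if F (toℕ r) then 0 else 1)

∏allowed : ℕ → (ℕ → Bool) → (ℕ → ℕ) → ℕ
∏allowed d F g = product {d} (λ r → if F (toℕ r) then 1 else g (toℕ r))

allowedParts-none : ∀ d → allowedParts d none ≡ d
allowedParts-none zero    = refl
allowedParts-none (suc d) = cong suc (allowedParts-none d)

allowedParts-forbid : ∀ d F {r₀} → r₀ < d → F r₀ ≡ false →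
                      allowedParts d F ≡ suc (allowedParts d (forbid r₀ F))
allowedParts-forbid d F {r₀} r₀<d F-r₀ = begin
  allowedParts d F                      ≡⟨ +-identityʳ _ ⟨
  allowedParts d F + 0                  ≡⟨ cong (allowedParts d F +_) (if-cong (forbid-self r₀ F)) ⟨
  allowedParts d F + ψ r₀               ≡⟨ ∑-exchange +-0-commutativeMonoid φ ψ r₀<d φ≡ψ ⟩
  allowedParts d (forbid r₀ F) + φ r₀   ≡⟨ cong (allowedParts d (forbid r₀ F) +_) (if-cong F-r₀) ⟩
  allowedParts d (forbid r₀ F) + 1      ≡⟨ +-comm _ 1 ⟩
  suc (allowedParts d (forbid r₀ F))    ∎
  where
  open ≡-Reasoning
  φ ψ : ℕ → ℕ
  φ r = if F r then 0 else 1
  ψ r = if forbid r₀ F r then 0 else 1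
  φ≡ψ : ∀ r → r ≢ r₀ → φ r ≡ ψ r
  φ≡ψ r r≢r₀ = if-cong (sym (forbid-≢ F (≢-sym r≢r₀)))

∏allowed-cong : ∀ d F (g h : ℕ → ℕ) →
                (∀ (r : Fin d) → F (toℕ r) ≡ false → g (toℕ r) ≡ h (toℕ r)) →
                ∏allowed d F g ≡ ∏allowed d F h
∏allowed-cong d F g h g≡h = product-cong-≗ agree
  where
  agree : ∀ (r : Fin d) →
          (if F (toℕ r) then 1 else g (toℕ r)) ≡ (if F (toℕ r) then 1 else h (toℕ r))
  agree r with F (toℕ r) in F-r
  ... | true  = refl
  ... | false = g≡h r F-r

-- The factor 1 + g r₀ of the allowed part r₀ splits into 1 (r₀ forbidden from now on) and g r₀.
∏allowed-split : ∀ d F (g h : ℕ → ℕ) {r₀} → r₀ < d → F r₀ ≡ false →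
                 h r₀ ≡ suc (g r₀) → (∀ r → r ≢ r₀ → h r ≡ g r) →
                 ∏allowed d F h ≡ ∏allowed d (forbid r₀ F) g + ∏allowed d F g
∏allowed-split d F g h {r₀} r₀<d F-r₀ h-r₀ h≡g = begin
  ∏allowed d F h                ≡⟨ *-identityʳ _ ⟨
  ∏allowed d F h * 1            ≡⟨ cong (∏allowed d F h *_) (if-cong (forbid-self r₀ F)) ⟨
  ∏allowed d F h * φ₂ r₀        ≡⟨ exchange φ₁ φ₂ φ₁≡φ₂ ⟩
  P₂ * φ₁ r₀                    ≡⟨ cong (P₂ *_) (trans (if-cong F-r₀) h-r₀) ⟩
  P₂ * suc (g r₀)               ≡⟨ *-suc P₂ (g r₀) ⟩
  P₂ + P₂ * g r₀                ≡⟨ cong (λ x → P₂ + P₂ * x) (if-cong F-r₀) ⟨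
  P₂ + P₂ * φ₃ r₀               ≡⟨ cong (P₂ +_) (exchange φ₃ φ₂ φ₃≡φ₂) ⟨
  P₂ + P₃ * φ₂ r₀               ≡⟨ cong (λ x → P₂ + P₃ * x) (if-cong (forbid-self r₀ F)) ⟩
  P₂ + P₃ * 1                   ≡⟨ cong (P₂ +_) (*-identityʳ P₃) ⟩
  P₂ + P₃                       ∎
  where
  open ≡-Reasoning
  exchange = λ φ ψ → ∑-exchange *-1-commutativeMonoid {d} φ ψ r₀<d
  P₂ = ∏allowed d (forbid r₀ F) g
  P₃ = ∏allowed d F g
  φ₁ φ₂ φ₃ : ℕ → ℕ
  φ₁ r = if F r then 1 else h r
  φ₂ r = if forbid r₀ F r then 1 else g r
  φ₃ r = if F r then 1 else g r
  φ₃≡φ₂ : ∀ r → r ≢ r₀ → φ₃ r ≡ φ₂ r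
  φ₃≡φ₂ r r≢r₀ = if-cong (sym (forbid-≢ F (≢-sym r≢r₀)))
  φ₁≡φ₂ : ∀ r → r ≢ r₀ → φ₁ r ≡ φ₂ r
  φ₁≡φ₂ r r≢r₀ = trans (if-cong-else (F r) (h≡g r r≢r₀)) (φ₃≡φ₂ r r≢r₀)

-- Only the empty set is counted, so the forbidden set G is irrelevant; keeping it apart from F
-- lets the induction on d shift F alone.
rainbowCount-empty : ∀ c G d F → rainbowCount c G 0 (allowedParts d F) ≡ ∏allowed d F (λ _ → 0)
rainbowCount-empty c G zero    F = refl
rainbowCount-empty c G (suc d) F with F 0
... | true  = trans (rainbowCount-empty c G d (F ∘ suc)) (sym (+-identityʳ _))
... | false = refl

rainbowCount-allowedParts : ∀ {d} c F n → (∀ i → c i < d) →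
                            rainbowCount c F n (allowedParts d F) ≡ ∏allowed d F (partSize c n)
rainbowCount-allowedParts {d} c F zero    _   = rainbowCount-empty c F d F
rainbowCount-allowedParts {d} c F (suc n) c<d with F (c 0) in F-c₀
... | true = begin
  rainbowCount c F (suc n) (allowedParts d F)
    ≡⟨ rainbowCount-forbidden c F n _ F-c₀ ⟩
  rainbowCount c′ F n (allowedParts d F)
    ≡⟨ rainbowCount-allowedParts c′ F n (c<d ∘ suc) ⟩
  ∏allowed d F (partSize c′ n)
    ≡⟨ ∏allowed-cong d F (partSize c′ n) (partSize c (suc n)) agree ⟩
  ∏allowed d F (partSize c (suc n)) ∎
  where
  open ≡-Reasoning
  c′ = c ∘ suc
  agree : ∀ (r : Fin d) → F (toℕ r) ≡ false → partSize c′ n (toℕ r) ≡ partSize c (suc n) (toℕ r)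
  agree r F-r = sym (partSize-suc-≢ c n (true-false⇒≢ F F-c₀ F-r))
... | false = begin
  rainbowCount c F (suc n) (allowedParts d F)
    ≡⟨ cong (rainbowCount c F (suc n)) aF≡1+aG ⟩
  rainbowCount c F (suc n) (suc (allowedParts d G))
    ≡⟨ rainbowCount-allowed c F n _ F-c₀ ⟩
  rainbowCount c′ G n (allowedParts d G) + rainbowCount c′ F n (suc (allowedParts d G))
    ≡⟨ cong₂ _+_ (rainbowCount-allowedParts c′ G n (c<d ∘ suc))
                 (trans (cong (rainbowCount c′ F n) (sym aF≡1+aG))
                        (rainbowCount-allowedParts c′ F n (c<d ∘ suc))) ⟩
  ∏allowed d G (partSize c′ n) + ∏allowed d F (partSize c′ n)
    ≡⟨ ∏allowed-split d F (partSize c′ n) (partSize c (suc n)) (c<d 0) F-c₀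
                      (partSize-suc-≡ c n) (λ r r≢c₀ → partSize-suc-≢ c n (≢-sym r≢c₀)) ⟨
  ∏allowed d F (partSize c (suc n)) ∎
  where
  open ≡-Reasoning
  c′ = c ∘ suc
  G = forbid (c 0) F
  aF≡1+aG : allowedParts d F ≡ suc (allowedParts d G)
  aF≡1+aG = allowedParts-forbid d F (c<d 0) F-c₀

-- A rainbow set avoiding F has at most allowedParts d F elements, so such a K bounds all sizes.
∑-rainbowCount : ∀ {d} c F n {K} → (∀ i → c i < d) → allowedParts d F < K →
                 ∑[ k < K ] rainbowCount c F n (toℕ k) ≡ ∏allowed d F (suc ∘ partSize c n)
∑-rainbowCount c F zero    {zero} _ ()
∑-rainbowCount c F (suc n) {zero} _ ()
∑-rainbowCount {d} c F zero {suc K} _ _ = begin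
  1 + ∑[ k < K ] 0               ≡⟨ cong suc (sum-replicate-zero K) ⟩
  1                              ≡⟨ product-replicate-one d ⟨
  product {d} (λ _ → 1)          ≡⟨ product-cong-≗ {d} (λ r → if-eta (F (toℕ r))) ⟨
  ∏allowed d F (λ _ → 1)         ∎
  where open ≡-Reasoning
∑-rainbowCount {d} c F (suc n) {suc K} c<d aF<K with F (c 0) in F-c₀
... | true = begin
  ∑[ k < suc K ] rainbowCount c F (suc n) (toℕ k)
    ≡⟨ sum-cong-≗ {suc K} (λ k → rainbowCount-forbidden c F n (toℕ k) F-c₀) ⟩
  ∑[ k < suc K ] rainbowCount c′ F n (toℕ k)
    ≡⟨ ∑-rainbowCount c′ F n (c<d ∘ suc) aF<K ⟩
  ∏allowed d F (suc ∘ partSize c′ n)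
    ≡⟨ ∏allowed-cong d F (suc ∘ partSize c′ n) (suc ∘ partSize c (suc n)) agree ⟩
  ∏allowed d F (suc ∘ partSize c (suc n)) ∎
  where
  open ≡-Reasoning
  c′ = c ∘ suc
  agree : ∀ (r : Fin d) → F (toℕ r) ≡ false →
          suc (partSize c′ n (toℕ r)) ≡ suc (partSize c (suc n) (toℕ r))
  agree r F-r = cong suc (sym (partSize-suc-≢ c n (true-false⇒≢ F F-c₀ F-r)))
... | false = begin
  ∑[ k < suc K ] rainbowCount c F (suc n) (toℕ k)
    ≡⟨ cong₂ _+_ (rainbowCount-zero c F n)
                 (sum-cong-≗ {K} (λ k → rainbowCount-allowed c F n (toℕ k) F-c₀)) ⟩
  rainbowCount c′ F n 0 + ∑[ k < K ] (rainbowCount c′ G n (toℕ k) + rainbowCount c′ F n (suc (toℕ k)))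
    ≡⟨ cong (rainbowCount c′ F n 0 +_) (∑-distrib-+ {K} (rainbowCount c′ G n ∘ toℕ) _) ⟩
  rainbowCount c′ F n 0 + (ΣG + ΣF⁺)
    ≡⟨ x∙yz≈y∙xz (rainbowCount c′ F n 0) ΣG ΣF⁺ ⟩
  ΣG + ∑[ k < suc K ] rainbowCount c′ F n (toℕ k)
    ≡⟨ cong₂ _+_ (∑-rainbowCount c′ G n (c<d ∘ suc) aG<K) (∑-rainbowCount c′ F n (c<d ∘ suc) aF<K) ⟩
  ∏allowed d G (suc ∘ partSize c′ n) + ∏allowed d F (suc ∘ partSize c′ n)
    ≡⟨ ∏allowed-split d F (suc ∘ partSize c′ n) (suc ∘ partSize c (suc n)) (c<d 0) F-c₀
                      (cong suc (partSize-suc-≡ c n))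
                      (λ r r≢c₀ → cong suc (partSize-suc-≢ c n (≢-sym r≢c₀))) ⟨
  ∏allowed d F (suc ∘ partSize c (suc n)) ∎
  where
  open ≡-Reasoning
  c′ = c ∘ suc
  G = forbid (c 0) F
  ΣG = ∑[ k < K ] rainbowCount c′ G n (toℕ k)
  ΣF⁺ = ∑[ k < K ] rainbowCount c′ F n (suc (toℕ k))
  aG<K : allowedParts d G < K
  aG<K = s<s⁻¹ (subst (_< suc K) (allowedParts-forbid d F (c<d 0) F-c₀) aF<K)

∑-applyUpTo : ∀ (g : ℕ → ℕ) K → List.sum (applyUpTo g K) ≡ ∑[ k < K ] g (toℕ k)
∑-applyUpTo g zero    = refl
∑-applyUpTo g (suc K) = cong (g 0 +_) (∑-applyUpTo (g ∘ suc) K)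

-- The identity holds for m = 0 as well.
lemma2p3 : (m d : ℕ) → 0 < m → .{{_ : NonZero d}} →
           sumBinomT m d ≡ binomT (m + d) d d
lemma2p3 m d _ = begin
  sumBinomT m d
    ≡⟨ cong List.sum (map-upTo _ (suc d)) ⟩
  List.sum (applyUpTo (λ k → binomT m k d) (suc d))
    ≡⟨ ∑-applyUpTo (λ k → binomT m k d) (suc d) ⟩
  ∑[ k < suc d ] binomT m (toℕ k) d
    ≡⟨ sum-cong-≗ {suc d} (λ k → binomT≡rainbowCount m (toℕ k) d) ⟩
  ∑[ k < suc d ] rainbowCount c none m (toℕ k)
    ≡⟨ ∑-rainbowCount c none m c<d (s≤s (≤-reflexive (allowedParts-none d))) ⟩
  ∏allowed d none (suc ∘ partSize c m)
    ≡⟨ ∏allowed-cong d none (suc ∘ partSize c m) (partSize c (m + d)) parts-grow ⟩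
  ∏allowed d none (partSize c (m + d))
    ≡⟨ rainbowCount-allowedParts c none (m + d) c<d ⟨
  rainbowCount c none (m + d) (allowedParts d none)
    ≡⟨ cong (rainbowCount c none (m + d)) (allowedParts-none d) ⟩
  rainbowCount c none (m + d) d
    ≡⟨ binomT≡rainbowCount (m + d) d d ⟨
  binomT (m + d) d d ∎
  where
  open ≡-Reasoning
  c : ℕ → ℕ
  c i = i % d
  c<d : ∀ i → c i < d
  c<d i = m%n<n i d
  parts-grow : ∀ (r : Fin d) → none (toℕ r) ≡ false →
               suc (partSize c m (toℕ r)) ≡ partSize c (m + d) (toℕ r)
  parts-grow r _ = sym (partSize-%-+ m (toℕ<n r))
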